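{- Let $\mathcal{A}$ be a finite, core-generated, well-connected inquisitive algebra. Then there is a finite poset (intuitionistic Kripke frame) $\mathfrak{F}$ such that $\mathcal{A}$ is isomorphic (via a bijection commuting with $\land,\lor,\to,0$ and mapping the core onto the core) to the structure $(\mathsf{Dw}^+(\mathsf{Up}(\mathfrak{F})),\mathsf{Dw}_p(\mathsf{Up}(\mathfrak{F})),\land,\lor,\to,0)$.
   Context: A Brouwerian semilattice is $(B,\land,\to,0)$ with $(B,\land)$ a meet-semilattice with least element $0$ and $a\land b\le c\iff a\le b\to c$. An inquisitive algebra is a first-order structure $\mathcal{A}=(A,A_c,\land,\lor,\to,0)$ with a unary predicate $A_c\subseteq A$ (the core, $\mathcal{A}_c$) such that, with $\langle\mathcal{A}_c\rangle$ the closure of $A_c$ under $\land,\lor,\to,0$, $(\langle A_c\rangle,\lor,\land,\to,0)$ is a Heyting algebra; $(A_c,\land,\to,0)$ is a Brouwerian semilattice; and $a\to(x\lor y)=(a\to x)\lor(a\to y)$ for all $a\in A_c$, $x,y\in\langle A_c\rangle$. It is core-generated if $A=\langle\mathcal{A}_c\rangle$, and well-connected if in $\langle\mathcal{A}_c\rangle$, $x\lor y=1$ implies $x=1$ or $y=1$ ($1:=0\to0$). For a poset $\mathfrak{F}=(W,R)$, $\mathsf{Up}(\mathfrak{F})$ is the set of $R$-upward closed subsets of $W$, ordered by $\subseteq$; $\mathsf{Dw}^+(\mathsf{Up}(\mathfrak{F}))$ is the set of nonempty downward closed subsets of $(\mathsf{Up}(\mathfrak{F}),\subseteq)$, a finite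 Heyting algebra under $\cap$ (meet), $\cup$ (join), its relative pseudocomplement $\to$, and bottom $0=\{\varnothing\}$; $\mathsf{Dw}_p(\mathsf{Up}(\mathfrak{F}))=\{\{t\}^\downarrow: t\in\mathsf{Up}(\mathfrak{F})\}$ is the set of principal downsets, where $\{t\}^\downarrow=\{s\in\mathsf{Up}(\mathfrak{F}):s\subseteq t\}$, used as the core. -}

module Defs where

open import Level using (0ℓ)
open import Data.Nat using (ℕ)
open import Data.Fin using (Fin)
open import Data.Fin.Subset using (Subset; _∈_; _⊆_) renaming (⊥ to ∅)
open import Data.Product using (Σ; ∃; _×_; _,_)
open import Data.Sum using (_⊎_)
open import Relation.Nullary using (Dec)
open import Relation.Binary.PropositionalEquality using (_≡_)
open import Relation.Binary using (Rel)
open import Function.Bundles using (_↔_)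

record InqSig (A : Set) : Set₁ where
  infixr 7 _∧_
  infixr 6 _∨_
  infixr 5 _⇒_
  field
    Core : A → Set
    _∧_ _∨_ _⇒_ : A → A → A
    𝟘 : A

  _≤_ : A → A → Set
  a ≤ b = a ∧ b ≡ a

  𝟙 : A
  𝟙 = 𝟘 ⇒ 𝟘

data Gen {A : Set} (S : InqSig A) : A → Set where
  core : ∀ {a} → InqSig.Core S a → Gen S a
  zero : Gen S (InqSig.𝟘 S)
  meet : ∀ {x y} → Gen S x → Gen S y → Gen S (InqSig._∧_ S x y)
  join : ∀ {x y} → Gen S x → Gen S y → Gen S (InqSig._∨_ S x y)
  imp  : ∀ {x y} → Gen S x → Gen S y → Gen S (InqSig._⇒_ S x y)

record IsInqAlg {A : Set} (S : InqSig A) : Set where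
  open InqSig S
  field
    -- (⟨A_c⟩, ∨, ∧, →, 0) is a Heyting algebra:
    -- a lattice with least element 0 and → the relative pseudocomplement
    -- (the top element 0 → 0 then exists by residuation).
    H-∧-comm  : ∀ {x y} → Gen S x → Gen S y → x ∧ y ≡ y ∧ x
    H-∨-comm  : ∀ {x y} → Gen S x → Gen S y → x ∨ y ≡ y ∨ x
    H-∧-assoc : ∀ {x y z} → Gen S x → Gen S y → Gen S z → (x ∧ y) ∧ z ≡ x ∧ (y ∧ z)
    H-∨-assoc : ∀ {x y z} → Gen S x → Gen S y → Gen S z → (x ∨ y) ∨ z ≡ x ∨ (y ∨ z)
    H-∧-absorbs-∨ : ∀ {x y} → Gen S x → Gen S y → x ∧ (x ∨ y) ≡ x
    H-∨-absorbs-∧ : ∀ {x y} → Gen S x → Gen S y → x ∨ (x ∧ y) ≡ x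
    H-𝟘-least : ∀ {x} → Gen S x → 𝟘 ≤ x
    H-residual-to   : ∀ {x y z} → Gen S x → Gen S y → Gen S z → (x ∧ y) ≤ z → x ≤ (y ⇒ z)
    H-residual-from : ∀ {x y z} → Gen S x → Gen S y → Gen S z → x ≤ (y ⇒ z) → (x ∧ y) ≤ z
    -- (A_c, ∧, →, 0) is a Brouwerian semilattice (in particular a substructure)
    C-𝟘 : Core 𝟘
    C-∧ : ∀ {a b} → Core a → Core b → Core (a ∧ b)
    C-⇒ : ∀ {a b} → Core a → Core b → Core (a ⇒ b)
    C-∧-comm  : ∀ {a b} → Core a → Core b → a ∧ b ≡ b ∧ a
    C-∧-assoc : ∀ {a b c} → Core a → Core b → Core c → (a ∧ b) ∧ c ≡ a ∧ (b ∧ c)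
    C-∧-idem  : ∀ {a} → Core a → a ∧ a ≡ a
    C-𝟘-least : ∀ {a} → Core a → 𝟘 ≤ a
    C-residual-to   : ∀ {a b c} → Core a → Core b → Core c → (a ∧ b) ≤ c → a ≤ (b ⇒ c)
    C-residual-from : ∀ {a b c} → Core a → Core b → Core c → a ≤ (b ⇒ c) → (a ∧ b) ≤ c
    split : ∀ {a x y} → Core a → Gen S x → Gen S y → a ⇒ (x ∨ y) ≡ (a ⇒ x) ∨ (a ⇒ y)

record InqAlg (A : Set) : Set₁ where
  field
    sig   : InqSig A
    isInq : IsInqAlg sig
  open InqSig sig public

module _ {A : Set} (𝒜 : InqAlg A) where
  open InqAlg 𝒜

  IsFinite : Set
  IsFinite = (∃ λ n → A ↔ Fin n) × (∀ a → Dec (Core a))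

  CoreGenerated : Set
  CoreGenerated = ∀ a → Gen sig a

  WellConnected : Set
  WellConnected = ∀ {x y} → Gen sig x → Gen sig y → x ∨ y ≡ 𝟙 → (x ≡ 𝟙) ⊎ (y ≡ 𝟙)

module _ {n : ℕ} (R : Rel (Fin n) 0ℓ) where

  IsUp : Subset n → Set
  IsUp U = ∀ {x y} → R x y → x ∈ U → y ∈ U

  -- a set of subsets of W (only up-sets will be members, see IsDwPlus)
  Pred : Set₁
  Pred = Subset n → Set

  record IsDwPlus (D : Pred) : Set where
    field
      dec      : ∀ s → Dec (D s)
      onlyUp   : ∀ {s} → D s → IsUp s
      downward : ∀ {s t} → IsUp s → s ⊆ t → D t → D s
      nonempty : ∃ λ s → D s

  _≈_ : Pred → Pred → Set
  D ≈ E = ∀ s → (D s → E s) × (E s → D s)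

  _∩_ : Pred → Pred → Pred
  (D ∩ E) s = D s × E s

  _∪_ : Pred → Pred → Pred
  (D ∪ E) s = D s ⊎ E s

  _⇛_ : Pred → Pred → Pred
  (D ⇛ E) s = IsUp s × (∀ t → IsUp t → t ⊆ s → D t → E t)

  bot : Pred
  bot s = s ≡ ∅

  ↓_ : Subset n → Pred
  (↓ t) s = IsUp s × s ⊆ t

  IsPrincipal : Pred → Set
  IsPrincipal D = ∃ λ t → IsUp t × D ≈ (↓ t)

record IsInqIso {A : Set} (𝒜 : InqAlg A) {n : ℕ} (R : Rel (Fin n) 0ℓ)
                (f : A → Pred R) : Set₁ where
  open InqAlg 𝒜
  field
    into       : ∀ a → IsDwPlus R (f a)
    injective  : ∀ {a b} → _≈_ R (f a) (f b) → a ≡ b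
    surjective : ∀ D → IsDwPlus R D → ∃ λ a → _≈_ R (f a) D
    hom-∧ : ∀ a b → _≈_ R (f (a ∧ b)) (_∩_ R (f a) (f b))
    hom-∨ : ∀ a b → _≈_ R (f (a ∨ b)) (_∪_ R (f a) (f b))
    hom-⇒ : ∀ a b → _≈_ R (f (a ⇒ b)) (_⇛_ R (f a) (f b))
    hom-𝟘 : _≈_ R (f 𝟘) (bot R)
    core-to   : ∀ {a} → Core a → IsPrincipal R (f a)
    core-from : ∀ {a} → IsPrincipal R (f a) → Core a

-- Every element is a join of core elements (distributivity and the split axiom push ∧ and ⇒
-- through joins), and by the split axiom plus well-connectedness core elements are join-prime.
-- So an element a is determined by the core elements below it. The core, a finite Brouwerian
-- semilattice, is dual to its poset F of meet-prime elements: a core element c corresponds to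
-- the up-set of points not above it, and an up-set s to the meet ψ s of the points outside s.
-- Hence a ↦ {s ∈ Up(F) ∣ ψ s ≤ a} is the required isomorphism onto Dw⁺(Up(F)); meet-prime
-- points separating core elements exist by taking maximal elements, using finiteness.

module Submission where

open import Defs renaming (_≈_ to _≃_)
open import Level using (0ℓ)
open import Data.Nat using (ℕ)
open import Data.Fin using (Fin; zero; suc)
import Data.Fin.Properties as Fin
open import Data.Fin.Subset using (Subset; _∈_; _∉_; _⊆_) renaming (⊥ to ∅)
open import Data.Fin.Subset.Properties using (_∈?_; ∉⊥; ⊥⊆; ⊆-antisym)
open import Data.Vec using (tabulate)
open import Data.Vec.Properties using ([]=⇒lookup; lookup⇒[]=; lookup∘tabulate)
open import Data.List using (List; []; _∷_; foldr; map; filter; length; lookup; allFin)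
open import Data.List.Membership.Propositional using (find) renaming (_∈_ to _∈ˡ_)
open import Data.List.Membership.Propositional.Properties
  using (∈-map⁺; ∈-map⁻; ∈-filter⁺; ∈-filter⁻; ∈-allFin; ∈-lookup)
open import Data.List.Relation.Unary.All as All using (All; []; _∷_)
open import Data.List.Relation.Unary.Any using (Any; here; there; index)
open import Data.List.Relation.Unary.Any.Properties using (lookup-index)
open import Data.List.Relation.Unary.Unique.Propositional using (Unique)
open import Data.List.Relation.Unary.AllPairs using (_∷_)
import Data.List.Relation.Unary.Unique.Propositional.Properties as Unique
open import Data.Product using (Σ; ∃; _×_; _,_; proj₁; proj₂)
open import Data.Sum using (_⊎_; inj₁; inj₂)
import Data.Sum as Sum
open import Function.Bundles using (_↔_; Inverse)
open import Function.Properties.Inverse using (↔⇒↣)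
open import Algebra.Consequences.Propositional using (comm∧distrˡ⇒distrʳ)
open import Algebra.Lattice.Structures using (IsLattice)
open import Algebra.Lattice.Bundles using (Lattice)
open import Algebra.Lattice.Properties.Lattice using (∨-∧-isOrderTheoreticLattice)
open import Relation.Binary using (Rel; IsPartialOrder; Poset; DecidableEquality)
open import Relation.Binary.Lattice using (HeytingAlgebra; BoundedLattice)
import Relation.Binary.Lattice.Properties.HeytingAlgebra as HeytingAlgebraProperties
open import Relation.Binary.PropositionalEquality
open import Relation.Nullary using (Dec; yes; no; ¬_; does; contradiction)
open import Relation.Nullary.Decidable
  using (_×-dec_; _⊎-dec_; _→-dec_; ¬?; map′; via-injection; dec-true; decidable-stable)

module HeytingAlgebraTop {c ℓ₁ ℓ₂} (H : HeytingAlgebra c ℓ₁ ℓ₂) where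
  open HeytingAlgebra H
    renaming (refl to ≤-refl; trans to ≤-trans; antisym to ≤-antisym; reflexive to ≤-reflexive)

  ≤⇒⇨≈⊤ : ∀ {x y} → x ≤ y → x ⇨ y ≈ ⊤
  ≤⇒⇨≈⊤ x≤y = ≤-antisym (maximum _) (transpose-⇨ (≤-trans (x∧y≤y _ _) x≤y))

  ⇨≈⊤⇒≤ : ∀ {x y} → x ⇨ y ≈ ⊤ → x ≤ y
  ⇨≈⊤⇒≤ {x} x⇨y≈⊤ =
    ≤-trans (∧-greatest (maximum x) ≤-refl) (transpose-∧ (≤-reflexive (Eq.sym x⇨y≈⊤)))

module BigOperators {c ℓ₁ ℓ₂} (L : BoundedLattice c ℓ₁ ℓ₂) where
  open BoundedLattice L renaming (trans to ≤-trans)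

  ⋀ ⋁ : List Carrier → Carrier
  ⋀ = foldr _∧_ ⊤
  ⋁ = foldr _∨_ ⊥

  ⋀-lower : ∀ {x xs} → x ∈ˡ xs → ⋀ xs ≤ x
  ⋀-lower (here refl) = x∧y≤x _ _
  ⋀-lower (there x∈xs) = ≤-trans (x∧y≤y _ _) (⋀-lower x∈xs)

  ⋀-greatest : ∀ {y xs} → All (y ≤_) xs → y ≤ ⋀ xs
  ⋀-greatest [] = maximum _
  ⋀-greatest (y≤x ∷ y≤xs) = ∧-greatest y≤x (⋀-greatest y≤xs)

  ⋁-upper : ∀ {x xs} → x ∈ˡ xs → x ≤ ⋁ xs
  ⋁-upper (here refl) = x≤x∨y _ _
  ⋁-upper (there x∈xs) = ≤-trans (⋁-upper x∈xs) (y≤x∨y _ _)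

  ⋁-prime : ∀ {y} → (∀ {a b} → y ≤ a ∨ b → y ≤ a ⊎ y ≤ b) →
            ∀ xs → y ≤ ⋁ xs → y ≤ ⊥ ⊎ Any (y ≤_) xs
  ⋁-prime prime [] y≤⊥ = inj₁ y≤⊥
  ⋁-prime prime (x ∷ xs) y≤⋁ with prime y≤⋁
  ... | inj₁ y≤x = inj₂ (here y≤x)
  ... | inj₂ y≤⋁xs = Sum.map₂ there (⋁-prime prime xs y≤⋁xs)

module MaximalElements {a ℓ₁ ℓ₂} (P : Poset a ℓ₁ ℓ₂) (_≤?_ : ∀ x y → Dec (Poset._≤_ P x y)) where
  open Poset P renaming (refl to ≤-refl; trans to ≤-trans; antisym to ≤-antisym)

  maximal-above : ∀ {q} {Q : Carrier → Set q} → (∀ x → Dec (Q x)) → ∀ xs {x} → Q x →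
                  ∃ λ m → Q m × x ≤ m × All (λ y → Q y → m ≤ y → m ≈ y) xs
  maximal-above Q? [] {x} qx = x , qx , ≤-refl , []
  maximal-above Q? (y ∷ ys) {x} qx with Q? y ×-dec x ≤? y
  ... | yes (qy , x≤y) =
    let m , qm , y≤m , m-max = maximal-above Q? ys qy
    in m , qm , ≤-trans x≤y y≤m , (λ _ m≤y → ≤-antisym m≤y y≤m) ∷ m-max
  ... | no ¬[qy×x≤y] =
    let m , qm , x≤m , m-max = maximal-above Q? ys qx
    in m , qm , x≤m , (λ qy m≤y → contradiction (qy , ≤-trans x≤m m≤y) ¬[qy×x≤y]) ∷ m-max

lookup-injective : ∀ {A : Set} {xs : List A} → Unique xs → ∀ {i j} → lookup xs i ≡ lookup xs j → i ≡ j
lookup-injective (_ ∷ _) {zero} {zero} _ = refl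
lookup-injective (x≢xs ∷ _) {zero} {suc j} x≡xⱼ = contradiction x≡xⱼ (All.lookup x≢xs (∈-lookup j))
lookup-injective (x≢xs ∷ _) {suc i} {zero} xᵢ≡x = contradiction (sym xᵢ≡x) (All.lookup x≢xs (∈-lookup i))
lookup-injective (_ ∷ unique) {suc i} {suc j} xᵢ≡xⱼ = cong suc (lookup-injective unique xᵢ≡xⱼ)

module _ {n : ℕ} {P : Fin n → Set} (P? : ∀ i → Dec (P i)) where

  subsetOf : Subset n
  subsetOf = tabulate (λ i → does (P? i))

  ∈-subsetOf⁺ : ∀ {i} → P i → i ∈ subsetOf
  ∈-subsetOf⁺ {i} pᵢ = lookup⇒[]= i _ (trans (lookup∘tabulate _ i) (dec-true (P? i) pᵢ))

  ∈-subsetOf⁻ : ∀ {i} → i ∈ subsetOf → P i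
  ∈-subsetOf⁻ {i} i∈ with P? i | trans (sym (lookup∘tabulate _ i)) ([]=⇒lookup i∈)
  ... | yes pᵢ | _ = pᵢ
  ... | no _ | ()

module CoreGeneratedInqAlg {A : Set} (𝒜 : InqAlg A) (cg : CoreGenerated 𝒜) where
  open InqAlg 𝒜 hiding (_≤_)
  open IsInqAlg isInq

  ∨-∧-isLattice : IsLattice _≡_ _∨_ _∧_
  ∨-∧-isLattice = record
    { isEquivalence = isEquivalence
    ; ∨-comm = λ x y → H-∨-comm (cg x) (cg y)
    ; ∨-assoc = λ x y z → H-∨-assoc (cg x) (cg y) (cg z)
    ; ∨-cong = cong₂ _∨_
    ; ∧-comm = λ x y → H-∧-comm (cg x) (cg y)
    ; ∧-assoc = λ x y z → H-∧-assoc (cg x) (cg y) (cg z)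
    ; ∧-cong = cong₂ _∧_
    ; absorptive = (λ x y → H-∨-absorbs-∧ (cg x) (cg y)) , (λ x y → H-∧-absorbs-∨ (cg x) (cg y))
    }

  private
    lattice : Lattice 0ℓ 0ℓ
    lattice = record { isLattice = ∨-∧-isLattice }

  -- The order of the lattice is  x ≤ y ⇔ x ≡ x ∧ y , the symmetric form of InqSig._≤_.
  heytingAlgebra : HeytingAlgebra 0ℓ 0ℓ 0ℓ
  heytingAlgebra = record
    { isHeytingAlgebra = record
      { isBoundedLattice = record
        { isLattice = ∨-∧-isOrderTheoreticLattice lattice
        ; maximum = λ x → residual-to (x∧y≤y x 𝟘)
        ; minimum = λ x → sym (H-𝟘-least (cg x))
        }
      ; exponential = λ w x y → residual-to , residual-from
      }
    }
    where
      open Relation.Binary.Lattice.IsLattice (∨-∧-isOrderTheoreticLattice lattice) using (x∧y≤y)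

      residual-to : ∀ {w x y} → w ∧ x ≡ (w ∧ x) ∧ y → w ≡ w ∧ (x ⇒ y)
      residual-to {w} {x} {y} w∧x≤y = sym (H-residual-to (cg w) (cg x) (cg y) (sym w∧x≤y))

      residual-from : ∀ {w x y} → w ≡ w ∧ (x ⇒ y) → w ∧ x ≡ (w ∧ x) ∧ y
      residual-from {w} {x} {y} w≤x⇒y = sym (H-residual-from (cg w) (cg x) (cg y) (sym w≤x⇒y))

  open HeytingAlgebra heytingAlgebra public
    using ( _≤_; x∧y≤x; x∧y≤y; ∧-greatest; x≤x∨y; y≤x∨y; ∨-least; maximum; minimum
          ; transpose-⇨; transpose-∧)
    renaming (refl to ≤-refl; trans to ≤-trans; antisym to ≤-antisym; reflexive to ≤-reflexive)
  open HeytingAlgebraProperties heytingAlgebra public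
    using (⇨-eval; swap-transpose-⇨; y≤x⇨y; ∧-distribˡ-∨; ⇨-distribˡ-∨-∧)
  open HeytingAlgebraTop heytingAlgebra public

  ∧-distribʳ-∨ : ∀ x y z → (y ∨ z) ∧ x ≡ (y ∧ x) ∨ (z ∧ x)
  ∧-distribʳ-∨ = comm∧distrˡ⇒distrʳ (IsLattice.∧-comm ∨-∧-isLattice) ∧-distribˡ-∨

  data JoinOfCores : A → Set where
    core : ∀ {c} → Core c → JoinOfCores c
    join : ∀ {x y} → JoinOfCores x → JoinOfCores y → JoinOfCores (x ∨ y)

  joinOfCores-∧ : ∀ {x y} → JoinOfCores x → JoinOfCores y → JoinOfCores (x ∧ y)
  joinOfCores-∧ (core cx) (core cy) = core (C-∧ cx cy)
  joinOfCores-∧ {x} (core cx) (join {y₁} {y₂} p q) =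
    subst JoinOfCores (sym (∧-distribˡ-∨ x y₁ y₂))
          (join (joinOfCores-∧ (core cx) p) (joinOfCores-∧ (core cx) q))
  joinOfCores-∧ {y = y} (join {x₁} {x₂} p q) r =
    subst JoinOfCores (sym (∧-distribʳ-∨ y x₁ x₂))
          (join (joinOfCores-∧ p r) (joinOfCores-∧ q r))

  joinOfCores-⇒ : ∀ {x y} → JoinOfCores x → JoinOfCores y → JoinOfCores (x ⇒ y)
  joinOfCores-⇒ (core cx) (core cy) = core (C-⇒ cx cy)
  joinOfCores-⇒ (core cx) (join {y₁} {y₂} p q) =
    subst JoinOfCores (sym (split cx (cg y₁) (cg y₂)))
          (join (joinOfCores-⇒ (core cx) p) (joinOfCores-⇒ (core cx) q))
  joinOfCores-⇒ {y = y} (join {x₁} {x₂} p q) r =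
    subst JoinOfCores (sym (⇨-distribˡ-∨-∧ x₁ x₂ y))
          (joinOfCores-∧ (joinOfCores-⇒ p r) (joinOfCores-⇒ q r))

  Gen⇒JoinOfCores : ∀ {a} → Gen sig a → JoinOfCores a
  Gen⇒JoinOfCores (core ca) = core ca
  Gen⇒JoinOfCores zero = core C-𝟘
  Gen⇒JoinOfCores (meet p q) = joinOfCores-∧ (Gen⇒JoinOfCores p) (Gen⇒JoinOfCores q)
  Gen⇒JoinOfCores (join p q) = join (Gen⇒JoinOfCores p) (Gen⇒JoinOfCores q)
  Gen⇒JoinOfCores (imp p q) = joinOfCores-⇒ (Gen⇒JoinOfCores p) (Gen⇒JoinOfCores q)

  ≤-by-cores : ∀ {a b} → (∀ {c} → Core c → c ≤ a → c ≤ b) → a ≤ b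
  ≤-by-cores {a} = go (Gen⇒JoinOfCores (cg a))
    where
      go : ∀ {a b} → JoinOfCores a → (∀ {c} → Core c → c ≤ a → c ≤ b) → a ≤ b
      go (core ca) h = h ca ≤-refl
      go (join p q) h = ∨-least (go p (λ cc c≤x → h cc (≤-trans c≤x (x≤x∨y _ _))))
                                (go q (λ cc c≤y → h cc (≤-trans c≤y (y≤x∨y _ _))))

  core-joinPrime : WellConnected 𝒜 → ∀ {c x y} → Core c → c ≤ x ∨ y → c ≤ x ⊎ c ≤ y
  core-joinPrime wc {c} {x} {y} cc c≤x∨y =
    Sum.map ⇨≈⊤⇒≤ ⇨≈⊤⇒≤ (wc (cg (c ⇒ x)) (cg (c ⇒ y)) (begin
      (c ⇒ x) ∨ (c ⇒ y)  ≡⟨ split cc (cg x) (cg y) ⟨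
      c ⇒ (x ∨ y)        ≡⟨ ≤⇒⇨≈⊤ c≤x∨y ⟩
      𝟙                  ∎))
    where open ≡-Reasoning

  𝟙-core : Core 𝟙
  𝟙-core = C-⇒ C-𝟘 C-𝟘

  open BigOperators (HeytingAlgebra.boundedLattice heytingAlgebra) public

  ⋀-core : ∀ {xs} → All Core xs → Core (⋀ xs)
  ⋀-core [] = 𝟙-core
  ⋀-core (cx ∷ cxs) = C-∧ cx (⋀-core cxs)

  MeetPrime : A → Set
  MeetPrime m = Core m × ¬ 𝟙 ≤ m × (∀ x y → Core x → Core y → x ∧ y ≤ m → x ≤ m ⊎ y ≤ m)

  ⋀-meetPrime : ∀ {m} → MeetPrime m → ∀ {xs} → All Core xs → ⋀ xs ≤ m → Any (_≤ m) xs
  ⋀-meetPrime (_ , 𝟙≰m , _) [] 𝟙≤m = contradiction 𝟙≤m 𝟙≰m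
  ⋀-meetPrime mp@(_ , _ , prime) (cx ∷ cxs) ⋀≤m with prime _ _ cx (⋀-core cxs) ⋀≤m
  ... | inj₁ x≤m = here x≤m
  ... | inj₂ ⋀xs≤m = there (⋀-meetPrime mp cxs ⋀xs≤m)

  module Finite (fin : IsFinite 𝒜) where
    private
      N : ℕ
      N = proj₁ (proj₁ fin)

      enumeration : A ↔ Fin N
      enumeration = proj₂ (proj₁ fin)

      open Inverse enumeration using (to; from; strictlyInverseˡ; strictlyInverseʳ)

    core? : ∀ a → Dec (Core a)
    core? = proj₂ fin

    elements : List A
    elements = map from (allFin N)

    ∈-elements : ∀ x → x ∈ˡ elements
    ∈-elements x = subst (_∈ˡ elements) (strictlyInverseʳ x) (∈-map⁺ from (∈-allFin (to x)))

    elements-unique : Unique elements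
    elements-unique = Unique.map⁺ from-injective (Unique.allFin⁺ N)
      where
        from-injective : ∀ {i j} → from i ≡ from j → i ≡ j
        from-injective {i} {j} eq =
          trans (sym (strictlyInverseˡ i)) (trans (cong to eq) (strictlyInverseˡ j))

    ∀? : {P : A → Set} → (∀ x → Dec (P x)) → Dec (∀ x → P x)
    ∀? P? = map′ (λ all x → All.lookup all (∈-elements x)) (λ all → All.tabulate (λ {x} _ → all x))
                 (All.all? P? elements)

    _≟_ : DecidableEquality A
    _≟_ = via-injection (↔⇒↣ enumeration) Fin._≟_

    infix 4 _≤?_
    _≤?_ : ∀ x y → Dec (x ≤ y)
    x ≤? y = x ≟ (x ∧ y)

    open MaximalElements (HeytingAlgebra.poset heytingAlgebra) _≤?_

    meetPrime? : ∀ m → Dec (MeetPrime m)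
    meetPrime? m = core? m ×-dec ¬? (𝟙 ≤? m) ×-dec ∀? (λ x → ∀? (λ y →
      core? x →-dec core? y →-dec x ∧ y ≤? m →-dec (x ≤? m ⊎-dec y ≤? m)))

    maximal⇒meetPrime : ∀ {c m} → Core c → Core m → ¬ c ≤ m →
                        (∀ {x} → Core x → m ≤ x → ¬ c ≤ x → m ≡ x) → MeetPrime m
    maximal⇒meetPrime {c} {m} cc cm c≰m m-max = cm , (λ 𝟙≤m → c≰m (≤-trans (maximum c) 𝟙≤m)) , prime
      where
        x⇒m≡m : ∀ {x} → Core x → ¬ c ≤ x ⇒ m → x ⇒ m ≡ m
        x⇒m≡m cx c≰x⇒m = sym (m-max (C-⇒ cx cm) y≤x⇨y c≰x⇒m)

        c⇒m≡m : c ⇒ m ≡ m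
        c⇒m≡m = x⇒m≡m cc (λ c≤c⇒m → c≰m (≤-trans (∧-greatest ≤-refl ≤-refl) (transpose-∧ c≤c⇒m)))

        prime : ∀ x y → Core x → Core y → x ∧ y ≤ m → x ≤ m ⊎ y ≤ m
        prime x y cx cy x∧y≤m with x ≤? m
        ... | yes x≤m = inj₁ x≤m
        ... | no x≰m = inj₂ (≤-trans (swap-transpose-⇨ x∧y≤m) (≤-reflexive (x⇒m≡m cx c≰x⇒m)))
          where
            c≰x⇒m : ¬ c ≤ x ⇒ m
            c≰x⇒m c≤x⇒m = x≰m (≤-trans (swap-transpose-⇨ (transpose-∧ c≤x⇒m)) (≤-reflexive c⇒m≡m))

    meetPrime-separation : ∀ {c d} → Core c → Core d → ¬ c ≤ d → ∃ λ m → MeetPrime m × d ≤ m × ¬ c ≤ m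
    meetPrime-separation {c} {d} cc cd c≰d
      with maximal-above (λ e → core? e ×-dec ¬? (c ≤? e)) elements {d} (cd , c≰d)
    ... | m , (cm , c≰m) , d≤m , m-max = m , maximal⇒meetPrime cc cm c≰m m-max′ , d≤m , c≰m
      where
        m-max′ : ∀ {x} → Core x → m ≤ x → ¬ c ≤ x → m ≡ x
        m-max′ {x} cx m≤x c≰x = All.lookup m-max (∈-elements x) (cx , c≰x) m≤x

    module Representation where
      opaque
        n : ℕ
        n = length (filter meetPrime? elements)

        pt : Fin n → A
        pt = lookup (filter meetPrime? elements)

        pt-meetPrime : ∀ i → MeetPrime (pt i)
        pt-meetPrime i = proj₂ (∈-filter⁻ meetPrime? {xs = elements} (∈-lookup i))

        pt-surjective : ∀ {m} → MeetPrime m → ∃ λ i → pt i ≡ m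
        pt-surjective {m} mp = index m∈points , sym (lookup-index m∈points)
          where
            m∈points : m ∈ˡ filter meetPrime? elements
            m∈points = ∈-filter⁺ meetPrime? (∈-elements m) mp

        pt-injective : ∀ {i j} → pt i ≡ pt j → i ≡ j
        pt-injective = lookup-injective (Unique.filter⁺ meetPrime? elements-unique)

      R : Rel (Fin n) 0ℓ
      R i j = pt j ≤ pt i

      R-isPartialOrder : IsPartialOrder _≡_ R
      R-isPartialOrder = record
        { isPreorder = record
          { isEquivalence = isEquivalence
          ; reflexive = λ { refl → ≤-refl }
          ; trans = λ Rij Rjk → ≤-trans Rjk Rij
          }
        ; antisym = λ Rij Rji → pt-injective (≤-antisym Rji Rij)
        }

      up? : ∀ s → Dec (IsUp R s)
      up? s = map′ (λ up {i} {j} → up i j) (λ up i j → up {i} {j})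
                   (Fin.all? λ i → Fin.all? λ j → pt j ≤? pt i →-dec i ∈? s →-dec j ∈? s)

      ∅-up : IsUp R ∅
      ∅-up _ i∈∅ = contradiction i∈∅ ∉⊥

      _∉?_ : ∀ (i : Fin n) s → Dec (i ∉ s)
      i ∉? s = ¬? (i ∈? s)

      outside : Subset n → List A
      outside s = map pt (filter (_∉? s) (allFin n))

      ∈-outside⁺ : ∀ {s i} → i ∉ s → pt i ∈ˡ outside s
      ∈-outside⁺ {s} i∉s = ∈-map⁺ pt (∈-filter⁺ (_∉? s) (∈-allFin _) i∉s)

      ∈-outside⁻ : ∀ {s x} → x ∈ˡ outside s → ∃ λ i → i ∉ s × x ≡ pt i
      ∈-outside⁻ {s} x∈ with ∈-map⁻ pt x∈
      ... | i , i∈ , x≡ptᵢ = i , proj₂ (∈-filter⁻ (_∉? s) {xs = allFin n} i∈) , x≡ptᵢ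

      outside-core : ∀ s → All Core (outside s)
      outside-core s = All.tabulate λ x∈ → let i , _ , x≡ptᵢ = ∈-outside⁻ {s} x∈ in
                                           subst Core (sym x≡ptᵢ) (proj₁ (pt-meetPrime i))

      ψ : Subset n → A
      ψ s = ⋀ (outside s)

      φ : A → Subset n
      φ c = subsetOf (λ i → ¬? (c ≤? pt i))

      ∈φ⁺ : ∀ {c i} → ¬ c ≤ pt i → i ∈ φ c
      ∈φ⁺ {c} = ∈-subsetOf⁺ (λ i → ¬? (c ≤? pt i))

      ∈φ⁻ : ∀ {c i} → i ∈ φ c → ¬ c ≤ pt i
      ∈φ⁻ {c} = ∈-subsetOf⁻ (λ i → ¬? (c ≤? pt i))

      ψ-core : ∀ s → Core (ψ s)
      ψ-core s = ⋀-core (outside-core s)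

      ψ-lower : ∀ {s i} → i ∉ s → ψ s ≤ pt i
      ψ-lower i∉s = ⋀-lower (∈-outside⁺ i∉s)

      ψ-greatest : ∀ {s x} → (∀ {i} → i ∉ s → x ≤ pt i) → x ≤ ψ s
      ψ-greatest {s} h = ⋀-greatest (All.tabulate λ y∈ → let i , i∉s , y≡ptᵢ = ∈-outside⁻ {s} y∈ in
                                                      subst (_ ≤_) (sym y≡ptᵢ) (h i∉s))

      ψ-mono : ∀ {s t} → s ⊆ t → ψ s ≤ ψ t
      ψ-mono {s} {t} s⊆t = ψ-greatest {t} λ i∉t → ψ-lower {s} (λ i∈s → i∉t (s⊆t i∈s))

      ψ-below-pt⇒∉ : ∀ {s i} → IsUp R s → ψ s ≤ pt i → i ∉ s
      ψ-below-pt⇒∉ {s} {i} up ψs≤ptᵢ i∈s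
        with find (⋀-meetPrime (pt-meetPrime i) (outside-core s) ψs≤ptᵢ)
      ... | x , x∈ , x≤ptᵢ with ∈-outside⁻ {s} x∈
      ... | j , j∉s , refl = j∉s (up x≤ptᵢ i∈s)

      φ-up : ∀ c → IsUp R (φ c)
      φ-up c ptⱼ≤ptᵢ i∈φc = ∈φ⁺ λ c≤ptⱼ → ∈φ⁻ i∈φc (≤-trans c≤ptⱼ ptⱼ≤ptᵢ)

      ψ≤⇒⊆φ : ∀ {s c} → IsUp R s → ψ s ≤ c → s ⊆ φ c
      ψ≤⇒⊆φ up ψs≤c i∈s = ∈φ⁺ λ c≤ptᵢ → ψ-below-pt⇒∉ up (≤-trans ψs≤c c≤ptᵢ) i∈s

      ≤ψ⇒φ⊆ : ∀ {c s} → c ≤ ψ s → φ c ⊆ s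
      ≤ψ⇒φ⊆ {s = s} c≤ψs {i} i∈φc =
        decidable-stable (i ∈? s) λ i∉s → ∈φ⁻ i∈φc (≤-trans c≤ψs (ψ-lower {s} i∉s))

      ψ-φ : ∀ {c} → Core c → ψ (φ c) ≡ c
      ψ-φ {c} cc = ≤-antisym ψφc≤c c≤ψφc
        where
          c≤ψφc : c ≤ ψ (φ c)
          c≤ψφc = ψ-greatest {φ c} λ {i} i∉φc → decidable-stable (c ≤? pt i) λ c≰ptᵢ → i∉φc (∈φ⁺ c≰ptᵢ)

          -- A point m ≥ c separating ψ (φ c) from c lies outside φ c, so ψ (φ c) ≤ m.
          ψφc≤c : ψ (φ c) ≤ c
          ψφc≤c = decidable-stable (ψ (φ c) ≤? c) λ ψφc≰c →
            let m , mp , c≤m , ψφc≰m = meetPrime-separation (ψ-core (φ c)) cc ψφc≰c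
                i , ptᵢ≡m = pt-surjective mp
                c≤ptᵢ = subst (c ≤_) (sym ptᵢ≡m) c≤m
            in ψφc≰m (subst (_ ≤_) ptᵢ≡m (ψ-lower {φ c} λ i∈φc → ∈φ⁻ i∈φc c≤ptᵢ))

      φ-ψ : ∀ {s} → IsUp R s → φ (ψ s) ≡ s
      φ-ψ up = ⊆-antisym (≤ψ⇒φ⊆ ≤-refl) (ψ≤⇒⊆φ up ≤-refl)

      φ𝟘≡∅ : φ 𝟘 ≡ ∅
      φ𝟘≡∅ = ⊆-antisym (λ i∈φ𝟘 → contradiction (minimum _) (∈φ⁻ i∈φ𝟘)) ⊥⊆

      ψ∅≡𝟘 : ψ ∅ ≡ 𝟘
      ψ∅≡𝟘 = trans (cong ψ (sym φ𝟘≡∅)) (ψ-φ C-𝟘)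

      f : A → Pred R
      f a s = IsUp R s × ψ s ≤ a

      φ∈f : ∀ {a c} → Core c → c ≤ a → f a (φ c)
      φ∈f {a} cc c≤a = φ-up _ , subst (_≤ a) (sym (ψ-φ cc)) c≤a

      φ∈f⇒≤ : ∀ {a c} → Core c → f a (φ c) → c ≤ a
      φ∈f⇒≤ {a} cc (_ , ψφc≤a) = subst (_≤ a) (ψ-φ cc) ψφc≤a

      f-reflects-≤ : ∀ {a b} → (∀ {s} → f a s → f b s) → a ≤ b
      f-reflects-≤ fa⊆fb = ≤-by-cores λ cc c≤a → φ∈f⇒≤ cc (fa⊆fb (φ∈f cc c≤a))

      f-isDwPlus : ∀ a → IsDwPlus R (f a)
      f-isDwPlus a = record
        { dec = λ s → up? s ×-dec ψ s ≤? a
        ; onlyUp = proj₁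
        ; downward = λ up s⊆t (_ , ψt≤a) → up , ≤-trans (ψ-mono s⊆t) ψt≤a
        ; nonempty = ∅ , ∅-up , subst (_≤ a) (sym ψ∅≡𝟘) (minimum a)
        }

      module Surjection (wc : WellConnected 𝒜) (D : Pred R) (D-isDwPlus : IsDwPlus R D) where
        open IsDwPlus D-isDwPlus

        generators : List A
        generators = filter (λ x → core? x ×-dec dec (φ x)) elements

        a : A
        a = ⋁ generators

        D-below-generator : ∀ {s x} → IsUp R s → Core x → D (φ x) → ψ s ≤ x → D s
        D-below-generator up _ Dφx ψs≤x = downward up (ψ≤⇒⊆φ up ψs≤x) Dφx

        D-φ𝟘 : D (φ 𝟘)
        D-φ𝟘 = let t , Dt = nonempty in subst D (sym φ𝟘≡∅) (downward ∅-up ⊥⊆ Dt)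

        f-a⊆D : ∀ {s} → f a s → D s
        f-a⊆D {s} (up , ψs≤a) with ⋁-prime (core-joinPrime wc (ψ-core s)) generators ψs≤a
        ... | inj₁ ψs≤𝟘 = D-below-generator up C-𝟘 D-φ𝟘 ψs≤𝟘
        ... | inj₂ ψs≤generator with find ψs≤generator
        ... | x , x∈ , ψs≤x =
          let cx , Dφx = proj₂ (∈-filter⁻ (λ x → core? x ×-dec dec (φ x)) {xs = elements} x∈)
          in D-below-generator up cx Dφx ψs≤x

        D⊆f-a : ∀ {s} → D s → f a s
        D⊆f-a {s} Ds = onlyUp Ds , ⋁-upper (∈-filter⁺ (λ x → core? x ×-dec dec (φ x)) (∈-elements (ψ s))
                                               (ψ-core s , subst D (sym (φ-ψ (onlyUp Ds))) Ds))

      f-∧ : ∀ a b → _≃_ R (f (a ∧ b)) (_∩_ R (f a) (f b))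
      f-∧ a b s = (λ (up , ψs≤a∧b) → (up , ≤-trans ψs≤a∧b (x∧y≤x a b))
                                    , (up , ≤-trans ψs≤a∧b (x∧y≤y a b)))
                , (λ ((up , ψs≤a) , (_ , ψs≤b)) → up , ∧-greatest ψs≤a ψs≤b)

      f-∨ : WellConnected 𝒜 → ∀ a b → _≃_ R (f (a ∨ b)) (_∪_ R (f a) (f b))
      f-∨ wc a b s = (λ (up , ψs≤a∨b) → Sum.map (up ,_) (up ,_) (core-joinPrime wc (ψ-core s) ψs≤a∨b))
                   , Sum.[ (λ (up , ψs≤a) → up , ≤-trans ψs≤a (x≤x∨y a b))
                         , (λ (up , ψs≤b) → up , ≤-trans ψs≤b (y≤x∨y a b)) ]

      f-⇒ : ∀ a b → _≃_ R (f (a ⇒ b)) (_⇛_ R (f a) (f b))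
      f-⇒ a b s = forth , back
        where
          forth : f (a ⇒ b) s → _⇛_ R (f a) (f b) s
          forth (up , ψs≤a⇒b) = up , λ t up-t t⊆s (_ , ψt≤a) →
            up-t , ≤-trans (∧-greatest (≤-trans (ψ-mono t⊆s) ψs≤a⇒b) ψt≤a) ⇨-eval

          back : _⇛_ R (f a) (f b) s → f (a ⇒ b) s
          back (up , fa⇒fb) = up , transpose-⇨ (≤-by-cores λ {c} cc c≤ψs∧a →
            φ∈f⇒≤ cc (fa⇒fb (φ c) (φ-up c) (≤ψ⇒φ⊆ (≤-trans c≤ψs∧a (x∧y≤x _ _)))
                                              (φ∈f cc (≤-trans c≤ψs∧a (x∧y≤y _ _)))))

      f-𝟘 : _≃_ R (f 𝟘) (bot R)
      f-𝟘 s = (λ (up , ψs≤𝟘) → ⊆-antisym (subst (s ⊆_) φ𝟘≡∅ (ψ≤⇒⊆φ up ψs≤𝟘)) ⊥⊆)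
            , (λ { refl → ∅-up , ≤-reflexive ψ∅≡𝟘 })

      f-core : ∀ {c} → Core c → _≃_ R (f c) (↓_ R (φ c))
      f-core cc s = (λ (up , ψs≤c) → up , ψ≤⇒⊆φ up ψs≤c)
                  , (λ (up , s⊆φc) → up , subst (ψ s ≤_) (ψ-φ cc) (ψ-mono s⊆φc))

      f-principal⇒core : ∀ {a} → IsPrincipal R (f a) → Core a
      f-principal⇒core {a} (t , up-t , fa≃↓t) = subst Core (≤-antisym ψt≤a a≤ψt) (ψ-core t)
        where
          ψt≤a : ψ t ≤ a
          ψt≤a = proj₂ (proj₂ (fa≃↓t t) (up-t , λ i∈t → i∈t))

          a≤ψt : a ≤ ψ t
          a≤ψt = ≤-by-cores λ cc c≤a → subst (_≤ ψ t) (ψ-φ cc)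
                   (ψ-mono (proj₂ (proj₁ (fa≃↓t _) (φ∈f cc c≤a))))

      f-isInqIso : WellConnected 𝒜 → IsInqIso 𝒜 R f
      f-isInqIso wc = record
        { into = f-isDwPlus
        ; injective = λ fa≃fb →
            ≤-antisym (f-reflects-≤ (proj₁ (fa≃fb _))) (f-reflects-≤ (proj₂ (fa≃fb _)))
        ; surjective = λ D D-isDwPlus → let open Surjection wc D D-isDwPlus in a , λ s → f-a⊆D , D⊆f-a
        ; hom-∧ = f-∧
        ; hom-∨ = f-∨ wc
        ; hom-⇒ = f-⇒
        ; hom-𝟘 = f-𝟘
        ; core-to = λ {c} cc → φ c , φ-up c , f-core cc
        ; core-from = f-principal⇒core
        }

proposition4p9 : {A : Set} (𝒜 : InqAlg A) → IsFinite 𝒜 → CoreGenerated 𝒜 → WellConnected 𝒜 →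
    Σ ℕ λ n → Σ (Rel (Fin n) 0ℓ) λ R → IsPartialOrder _≡_ R × Σ (A → Pred R) λ f → IsInqIso 𝒜 R f
proposition4p9 𝒜 fin cg wc = n , R , R-isPartialOrder , f , f-isInqIso wc
  where
    open CoreGeneratedInqAlg 𝒜 cg
    open Finite fin
    open Representation
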